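{- Let $P=([n],\preceq)$ be a poset, $w$ a weight on $\mathbb{F}_q$, and $\mathbb{C}\subseteq\mathbb{F}_q^n$ a code with $|\mathbb{C}|\ge2$. Then $\big\lfloor\frac{d_{(P,w)}(\mathbb{C})-1}{M_w}\big\rfloor\le d_P(\mathbb{C})-1$.
   Context: A weight on $\mathbb{F}_q$ is a map $w:\mathbb{F}_q\to\mathbb{N}\cup\{0\}$ with $w(\alpha)=0$ iff $\alpha=0$, $w(-\alpha)=w(\alpha)$, $w(\alpha+\beta)\le w(\alpha)+w(\beta)$; $M_w=\max_\alpha w(\alpha)$. Ideals of $P$ are down-closed subsets; $\langle A\rangle$ is the generated ideal. For $u\in\mathbb{F}_q^n$, $supp(u)=\{i:u_i\ne0\}$, $I_u=\langle supp(u)\rangle$, $M_u$ its maximal elements, $w_{(P,w)}(u)=\sum_{i\in M_u}w(u_i)+|I_u\setminus M_u|\,M_w$ and $w_P(u)=|I_u|$. The distances are $d_{(P,w)}(u,v)=w_{(P,w)}(u-v)$, $d_P(u,v)=w_P(u-v)$, and $d_{(P,w)}(\mathbb{C})$, $d_P(\mathbb{C})$ are the corresponding minimum distances between distinct codewords. -}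

module Defs where

open import Level using (0ℓ)
open import Algebra.Bundles using (CommutativeRing)
open import Data.Nat using (ℕ; zero; suc; _≤_; _⊔_) renaming (_+_ to _+ℕ_; _*_ to _*ℕ_)
open import Data.Fin using (Fin)
open import Data.Fin.Properties using (any?; all?)
open import Data.List using (List; foldr; map; length; filter)
open import Data.Nat.ListAction using (sum)
open import Data.Nat.Base using (NonZero; ≢-nonZero)
open import Data.Nat.Properties using (≤-trans; ≤-reflexive; m≤m⊔n; m≤n⇒m≤o⊔n; n≤0⇒n≡0)
open import Data.List.Relation.Unary.Any using (here; there)
open import Relation.Binary.PropositionalEquality using (sym; cong)
open import Data.List.Relation.Unary.Any using (Any)
open import Data.List.Membership.Propositional using () renaming (_∈_ to _∈L_)
open import Data.Vec.Functional using (Vector)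
open import Data.Product using (Σ; ∃; _×_; _,_)
open import Data.Sum using (_⊎_)
open import Relation.Nullary using (¬_; Dec; yes; no)
open import Relation.Nullary.Decidable using (_×-dec_; ¬?)
open import Relation.Binary using (Rel; Decidable; IsPartialOrder)
open import Relation.Binary.PropositionalEquality using (_≡_)
open import Data.List using (allFin)
import Data.Fin
import Data.List
import Relation.Binary
import Relation.Nullary

record FiniteField : Set₁ where
  field
    commRing : CommutativeRing 0ℓ 0ℓ
  open CommutativeRing commRing public
  field
    _≟_      : Decidable _≈_
    0≉1      : ¬ (0# ≈ 1#)
    inverse  : ∀ x → ¬ (x ≈ 0#) → ∃ λ y → (x * y) ≈ 1#
    elems    : List Carrier
    complete : ∀ x → Any (x ≈_) elems

record Weight (F : FiniteField) : Set where
  open FiniteField F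
  field
    w        : Carrier → ℕ
    w-cong   : ∀ {a b} → a ≈ b → w a ≡ w b
    w-zero   : ∀ a → (w a ≡ 0 → a ≈ 0#) × (a ≈ 0# → w a ≡ 0)
    w-neg    : ∀ a → w (- a) ≡ w a
    w-tri    : ∀ a b → w (a + b) ≤ w a +ℕ w b

module _ {F : FiniteField} where
  open FiniteField F

  Mw : Weight F → ℕ
  Mw W = foldr _⊔_ 0 (map (Weight.w W) elems)

  -- helper fact: M_w ≥ 1 (as 1 ≠ 0 in a field), so ⌊ · / M_w ⌋ makes sense
  Mw-nonZero : (W : Weight F) → NonZero (Mw W)
  Mw-nonZero W = ≢-nonZero λ eq → 0≉1 (sym′ (proj₁ (w-zero 1#) (n≤0⇒n≡0 (≤-trans (bound (complete 1#)) (≤-reflexive eq)))))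
    where
      open Weight W
      open import Data.Product using (proj₁)
      sym′ : ∀ {a b} → a ≈ b → b ≈ a
      sym′ = Relation.Binary.IsEquivalence.sym isEquivalence
      bound : ∀ {xs} → Any (1# ≈_) xs → w 1# ≤ foldr _⊔_ 0 (map w xs)
      bound {x Data.List.∷ xs} (here p) = ≤-trans (≤-reflexive (w-cong p)) (m≤m⊔n (w x) _)
      bound {x Data.List.∷ xs} (there p) = m≤n⇒m≤o⊔n (w x) (bound p)

record FinPoset (n : ℕ) : Set₁ where
  field
    _≼_       : Rel (Fin n) 0ℓ
    isPartialOrder : IsPartialOrder _≡_ _≼_
    _≼?_      : Decidable _≼_

count : ∀ {n} {P : Fin n → Set} → (∀ i → Dec (P i)) → ℕ
count {n} P? = length (filter P? (allFin n))

sumOver : ∀ {n} {P : Fin n → Set} → (∀ i → Dec (P i)) → (Fin n → ℕ) → ℕ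
sumOver {n} P? f = sum (map f (filter P? (allFin n)))

module _ {F : FiniteField} {n : ℕ} (P : FinPoset n) where
  open FiniteField F
  open FinPoset P

  Supp : Vector Carrier n → Fin n → Set
  Supp u i = ¬ (u i ≈ 0#)

  supp? : ∀ u i → Dec (Supp u i)
  supp? u i = ¬? (u i ≟ 0#)

  Ideal : Vector Carrier n → Fin n → Set
  Ideal u j = ∃ λ i → Supp u i × (j ≼ i)

  ideal? : ∀ u j → Dec (Ideal u j)
  ideal? u j = any? (λ i → supp? u i ×-dec (j ≼? i))

  Maximal : Vector Carrier n → Fin n → Set
  Maximal u i = Ideal u i × (∀ j → Ideal u j → i ≼ j → j ≡ i)

  maximal? : ∀ u i → Dec (Maximal u i)
  maximal? u i = ideal? u i ×-dec all? (λ j → dec j)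
    where
      dec : ∀ j → Dec (Ideal u j → i ≼ j → j ≡ i)
      dec j with ideal? u j | i ≼? j | Data.Fin._≟_ j i
      ... | no ¬a | _ | _ = yes (λ a _ → Relation.Nullary.contradiction a ¬a)
      ... | yes a | no ¬b | _ = yes (λ _ b → Relation.Nullary.contradiction b ¬b)
      ... | yes a | yes b | yes e = yes (λ _ _ → e)
      ... | yes a | yes b | no ¬e = no (λ f → ¬e (f a b))

  nonMaximal? : ∀ u i → Dec (Ideal u i × ¬ Maximal u i)
  nonMaximal? u i = ideal? u i ×-dec ¬? (maximal? u i)

  wP : Vector Carrier n → ℕ
  wP u = count (ideal? u)

  wPw : Weight F → Vector Carrier n → ℕ
  wPw W u = sumOver (maximal? u) (λ i → Weight.w W (u i))
            +ℕ count (nonMaximal? u) *ℕ Mw W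

  _⊖_ : Vector Carrier n → Vector Carrier n → Vector Carrier n
  (u ⊖ v) i = u i - v i

  dP : Vector Carrier n → Vector Carrier n → ℕ
  dP u v = wP (u ⊖ v)

  dPw : Weight F → Vector Carrier n → Vector Carrier n → ℕ
  dPw W u v = wPw W (u ⊖ v)

  _≉ᵥ_ : Vector Carrier n → Vector Carrier n → Set
  u ≉ᵥ v = ¬ (∀ i → u i ≈ v i)

  AtLeastTwo : (Vector Carrier n → Set) → Set
  AtLeastTwo C = ∃ λ u → ∃ λ v → C u × C v × u ≉ᵥ v

  IsMinDistance : (Vector Carrier n → Vector Carrier n → ℕ)
                → (Vector Carrier n → Set) → ℕ → Set
  IsMinDistance dist C d =
    (∃ λ u → ∃ λ v → C u × C v × u ≉ᵥ v × dist u v ≡ d)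
    × (∀ u v → C u → C v → u ≉ᵥ v → d ≤ dist u v)

{-# OPTIONS --safe #-}
module Submission where

-- Every maximal element of I_u contributes w(u_i) ≤ M_w and every other element of I_u
-- contributes exactly M_w, so w_(P,w)(u) ≤ |I_u| · M_w = w_P(u) · M_w. Applied to a pair of
-- codewords at P-distance d_P(C), this gives d_(P,w)(C) ≤ d_P(C) · M_w, and dividing by M_w
-- yields the claim.

open import Defs
open import Data.Nat using (ℕ; zero; suc; _+_; _*_; _≤_; _∸_; _⊔_; z≤n; s≤s; NonZero)
open import Data.Nat.DivMod using (_/_; 0/n≡0; m<n*o⇒m/o<n)
open import Data.Nat.ListAction using (sum)
open import Data.Nat.Properties
open import Data.List using (List; []; _∷_; filter; map; length; foldr; allFin)
open import Data.List.Relation.Unary.Any using (Any; here; there)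
open import Data.Vec.Functional using (Vector)
open import Data.Product using (_,_; _×_; proj₁; proj₂)
open import Data.Empty using (⊥-elim)
open import Relation.Nullary using (Dec; yes; no; ¬_)
open import Relation.Binary.PropositionalEquality using (sym; subst)

sum-map-≤-length* : {A : Set} (f : A → ℕ) {M : ℕ} → (∀ x → f x ≤ M) →
                    (xs : List A) → sum (map f xs) ≤ length xs * M
sum-map-≤-length* f f≤M []       = z≤n
sum-map-≤-length* f f≤M (x ∷ xs) = +-mono-≤ (f≤M x) (sum-map-≤-length* f f≤M xs)

length-filter-disjoint-≤ : {A : Set} {P Q R : A → Set}
  (P? : ∀ x → Dec (P x)) (Q? : ∀ x → Dec (Q x)) (R? : ∀ x → Dec (R x)) →
  (∀ x → P x → R x) → (∀ x → Q x → R x) → (∀ x → P x → ¬ Q x) →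
  (xs : List A) → length (filter P? xs) + length (filter Q? xs) ≤ length (filter R? xs)
length-filter-disjoint-≤ P? Q? R? P⊆R Q⊆R P∩Q=∅ [] = z≤n
length-filter-disjoint-≤ P? Q? R? P⊆R Q⊆R P∩Q=∅ (x ∷ xs)
  with ih ← length-filter-disjoint-≤ P? Q? R? P⊆R Q⊆R P∩Q=∅ xs | P? x | Q? x | R? x
... | yes p | yes q | _     = ⊥-elim (P∩Q=∅ x p q)
... | yes p | no _  | no ¬r = ⊥-elim (¬r (P⊆R x p))
... | yes _ | no _  | yes _ = s≤s ih
... | no _  | yes q | no ¬r = ⊥-elim (¬r (Q⊆R x q))
... | no _  | yes _ | yes _ = ≤-trans (≤-reflexive (+-suc _ _)) (s≤s ih)
... | no _  | no _  | no _  = ih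
... | no _  | no _  | yes _ = m≤n⇒m≤1+n ih

module _ {F : FiniteField} (W : Weight F) where
  open FiniteField F using (Carrier; _≈_; complete)
  open Weight W

  w≤Mw : ∀ x → w x ≤ Mw W
  w≤Mw x = w≤foldr-⊔ (complete x)
    where
      w≤foldr-⊔ : ∀ {xs} → Any (x ≈_) xs → w x ≤ foldr _⊔_ 0 (map w xs)
      w≤foldr-⊔ {y ∷ _} (here x≈y) = ≤-trans (≤-reflexive (w-cong x≈y)) (m≤m⊔n (w y) _)
      w≤foldr-⊔ {y ∷ _} (there x∈xs) = m≤n⇒m≤o⊔n (w y) (w≤foldr-⊔ x∈xs)

  wPw≤wP*Mw : ∀ {n} (P : FinPoset n) (u : Vector Carrier n) → wPw {F = F} P W u ≤ wP {F = F} P u * Mw W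
  wPw≤wP*Mw {n} P u = begin
    sumOver max? (λ i → w (u i)) + count nonMax? * Mw W
      ≤⟨ +-monoˡ-≤ _ (sum-map-≤-length* (λ i → w (u i)) (λ i → w≤Mw (u i)) (filter max? (allFin n))) ⟩
    count max? * Mw W + count nonMax? * Mw W
      ≡⟨ *-distribʳ-+ (Mw W) (count max?) (count nonMax?) ⟨
    (count max? + count nonMax?) * Mw W
      ≤⟨ *-monoˡ-≤ (Mw W) (length-filter-disjoint-≤ max? nonMax? (ideal? {F = F} P u)
                             (λ _ → proj₁) (λ _ → proj₁) (λ _ max nonMax → proj₂ nonMax max) (allFin n)) ⟩
    wP {F = F} P u * Mw W ∎
    where
      open ≤-Reasoning
      max? : ∀ i → Dec (Maximal {F = F} P u i)
      max? = maximal? {F = F} P u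
      nonMax? : ∀ i → Dec (Ideal {F = F} P u i × ¬ Maximal {F = F} P u i)
      nonMax? = nonMaximal? {F = F} P u

pred-/-≤-pred : ∀ a k M .{{_ : NonZero M}} → a ≤ k * M → (a ∸ 1) / M ≤ k ∸ 1
pred-/-≤-pred zero    k M _    = subst (_≤ k ∸ 1) (sym (0/n≡0 M)) z≤n
pred-/-≤-pred (suc a) k M a≤kM = <⇒≤pred (m<n*o⇒m/o<n {a} {k} {M} a≤kM)

proposition4p2 : (F : FiniteField) (n : ℕ) (P : FinPoset n) (W : Weight F)
                 (C : Vector (FiniteField.Carrier F) n → Set) →
                 AtLeastTwo {F = F} P C →
                 (dPwC dPC : ℕ) →
                 IsMinDistance {F = F} P (dPw P W) C dPwC →
                 IsMinDistance {F = F} P (dP {F = F} P) C dPC →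
                 _/_ (dPwC ∸ 1) (Mw W) {{Mw-nonZero W}} ≤ dPC ∸ 1
proposition4p2 F n P W C _ dPwC dPC (_ , dPwC-min) ((u , v , u∈C , v∈C , u≉v , dP[u,v]≡dPC) , _) =
  pred-/-≤-pred dPwC dPC (Mw W) {{Mw-nonZero W}} dPwC≤dPC*Mw
  where
    dPwC≤dPC*Mw : dPwC ≤ dPC * Mw W
    dPwC≤dPC*Mw = ≤-trans (dPwC-min u v u∈C v∈C u≉v)
      (subst (λ k → dPw P W u v ≤ k * Mw W) dP[u,v]≡dPC (wPw≤wP*Mw W P (_⊖_ {F = F} P u v)))
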